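{- If a graph $G$ has a perfect matching, then for every positive integer $k$, $G$ has a spanning maximum $k$-edge-colorable subgraph.
   Context: Graphs are finite, undirected, without loops, but may have multiple edges. A subgraph $H$ of $G$ is spanning if every vertex of $G$ has degree at least $1$ in $H$. A graph is $k$-edge-colorable if its edge set can be partitioned into $k$ matchings. A maximum $k$-edge-colorable subgraph of $G$ is a $k$-edge-colorable subgraph of $G$ with the maximum possible number of edges. -}

module Defs where

open import Data.Nat using (ℕ; _≤_)
open import Data.Fin using (Fin)
open import Data.Fin.Subset using (Subset; _∈_; ∣_∣)
open import Data.Product using (Σ; _×_; proj₁; proj₂; ∃-syntax)
open import Relation.Binary.PropositionalEquality using (_≡_; _≢_)
open import Data.Sum using (_⊎_)
open import Relation.Nullary using (¬_)

-- A finite loopless multigraph: n vertices Fin n, m edges Fin m, each edge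
-- has two distinct endpoints. Parallel edges are allowed.
record Graph : Set where
  field
    n     : ℕ
    m     : ℕ
    ends  : Fin m → Fin n × Fin n
    loopless : ∀ e → proj₁ (ends e) ≢ proj₂ (ends e)

module _ (G : Graph) where
  open Graph G

  IncidentTo : Fin n → Fin m → Set
  IncidentTo v e = (proj₁ (ends e) ≡ v) ⊎ (proj₂ (ends e) ≡ v)

  -- a subgraph is given by its edge set (all vertices of G are kept)
  Subgraph : Set
  Subgraph = Subset m

  Matching : Subgraph → Set
  Matching S = ∀ e f → e ∈ S → f ∈ S → e ≢ f →
               ∀ v → IncidentTo v e → ¬ IncidentTo v f

  Spanning : Subgraph → Set
  Spanning H = ∀ v → ∃[ e ] (e ∈ H × IncidentTo v e)

  PerfectMatching : Subgraph → Set
  PerfectMatching M = Matching M × Spanning M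

  HasPerfectMatching : Set
  HasPerfectMatching = ∃[ M ] PerfectMatching M

  KEdgeColorable : ℕ → Subgraph → Set
  KEdgeColorable k H = Σ (Fin m → Fin k) λ c → (∀ e f → e ∈ H → f ∈ H → e ≢ f →
                         c e ≡ c f → ∀ v → IncidentTo v e → ¬ IncidentTo v f)

  MaxKEdgeColorable : ℕ → Subgraph → Set
  MaxKEdgeColorable k H = KEdgeColorable k H ×
    (∀ H′ → KEdgeColorable k H′ → ∣ H′ ∣ ≤ ∣ H ∣)

module Submission where

-- Among all properly k-edge-coloured subgraphs (H , c) choose one maximising,
-- lexicographically, first ∣ H ∣ and then ∣ H ∩ M ∣; the two criteria are
-- combined into the single number ∣ H ∣ * (m + 1) + ∣ H ∩ M ∣.  Such an H is a
-- maximum k-edge-colourable subgraph by the first criterion.  It is spanning: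
-- if a vertex v were missed by H, let e = vu be its edge in M.
--   * If u is also missed by H, adding e with any colour enlarges H.
--   * Otherwise some f ∈ H covers u; f ∉ M because M is a matching.  Removing
--     f and giving e the colour of f is again proper, keeps ∣ H ∣ and increases
--     ∣ H ∩ M ∣.
-- Either way the choice of H is contradicted.

open import Defs
open import Data.Nat using (ℕ; suc; _≤_; _<_; _+_; _*_)
open import Data.Nat.Properties using (<⇒≱; ≮⇒≥; +-monoʳ-≤; +-monoʳ-<; +-mono-≤-<; *-monoˡ-≤; +-comm; m≤m+n; n<1+n; module ≤-Reasoning)
open import Data.Bool using (true; false)
open import Data.Fin using (Fin; zero; suc; _≟_)
open import Data.Fin.Properties using (any?; all?)
open import Data.Fin.Subset using (Subset; _∈_; _∉_; _⊆_; _⊂_; ∣_∣; _∩_; _∪_; _-_; ⁅_⁆; inside; outside) renaming (⊥ to ∅)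
open import Data.Fin.Subset.Properties using (_∈?_; ∣p∣≤n; p⊂q⇒∣p∣<∣q∣; p─⊥≡p; p─q⊆p; x∈p∧x≢y⇒x∈p-y; p⊆p∪q; x∈p∪q⁺; x∈p∪q⁻; x∈⁅x⁆; x∈⁅y⁆⇒x≡y; x∈p∩q⁺; x∈p∩q⁻; ∉⊥)
open import Data.Vec using (Vec; []; _∷_; here; there; lookup; tabulate; replicate)
open import Data.Vec.Properties using (lookup∘tabulate)
open import Data.List using (List; cartesianProduct; cartesianProductWith; allFin; filter) renaming ([] to []ₗ; _∷_ to _∷ₗ_)
open import Data.List.Membership.Propositional using () renaming (_∈_ to _∈ₗ_)
open import Data.List.Membership.Propositional.Properties using (∈-cartesianProductWith⁺; ∈-cartesianProduct⁺; ∈-filter⁺; ∈-allFin)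
import Data.List.Relation.Unary.Any as Any
import Data.List.Relation.Unary.All as All
open import Data.List.Relation.Unary.All.Properties using (all-filter)
open import Data.List.Extrema.Nat using (argmax; argmax-all; f[xs]≤f[argmax])
open import Data.Product using (_×_; _,_; proj₁; proj₂; ∃-syntax)
open import Data.Sum using (_⊎_; inj₁; inj₂)
open import Data.Empty using (⊥; ⊥-elim)
open import Function using (_∘_)
open import Relation.Nullary using (¬_; Dec; yes; no)
open import Relation.Nullary.Decidable using (_×-dec_; _⊎-dec_; _→-dec_; ¬?)
open import Relation.Unary using (Decidable)
open import Relation.Binary.PropositionalEquality using (_≡_; _≢_; refl; sym; trans; cong; subst)

vectors : {A : Set} → List A → (n : ℕ) → List (Vec A n)
vectors xs 0       = [] ∷ₗ []ₗ
vectors xs (suc n) = cartesianProductWith _∷_ xs (vectors xs n)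

∈-vectors : {A : Set} {xs : List A} → (∀ a → a ∈ₗ xs) → ∀ {n} (v : Vec A n) → v ∈ₗ vectors xs n
∈-vectors complete []      = Any.here refl
∈-vectors complete (a ∷ v) = ∈-cartesianProductWith⁺ _∷_ (complete a) (∈-vectors complete v)

maximiser : {A : Set} {P : A → Set} → Decidable P → (f : A → ℕ) →
            (xs : List A) → (∀ a → a ∈ₗ xs) → ∀ {a₀} → P a₀ →
            ∃[ a ] (P a × (∀ b → P b → f b ≤ f a))
maximiser {A} P? f xs complete {a₀} Pa₀ =
  argmax f a₀ candidates ,
  argmax-all f Pa₀ (all-filter P? xs) ,
  λ b Pb → All.lookup (f[xs]≤f[argmax] a₀ candidates) (∈-filter⁺ P? (complete b) Pb)
  where
  candidates : List A
  candidates = filter P? xs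

-- Encodes the pair (a , x) with x ≤ m as one number, ordered lexicographically.
lexWeight : ℕ → ℕ → ℕ → ℕ
lexWeight m a x = a * suc m + x

lexWeight-<ˡ : ∀ {m a b} x y → x ≤ m → a < b → lexWeight m a x < lexWeight m b y
lexWeight-<ˡ {m} {a} {b} x y x≤m a<b = begin-strict
  a * suc m + x     ≤⟨ +-monoʳ-≤ (a * suc m) x≤m ⟩
  a * suc m + m     <⟨ +-monoʳ-< (a * suc m) (n<1+n m) ⟩
  a * suc m + suc m ≡⟨ +-comm (a * suc m) (suc m) ⟩
  suc a * suc m     ≤⟨ *-monoˡ-≤ (suc m) a<b ⟩
  b * suc m         ≤⟨ m≤m+n (b * suc m) y ⟩
  b * suc m + y     ∎
  where open ≤-Reasoning

lexWeight-<ʳ : ∀ {m a b x y} → a ≤ b → x < y → lexWeight m a x < lexWeight m b y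
lexWeight-<ʳ {m} a≤b x<y = +-mono-≤-< (*-monoˡ-≤ (suc m) a≤b) x<y

lexWeight-≤⇒≤ : ∀ {m a b x y} → y ≤ m → lexWeight m a x ≤ lexWeight m b y → a ≤ b
lexWeight-≤⇒≤ {x = x} {y} y≤m ≤w = ≮⇒≥ (λ b<a → <⇒≱ (lexWeight-<ˡ y x y≤m b<a) ≤w)

∣p∣≡1+∣p-x∣ : ∀ {n} {p : Subset n} {x} → x ∈ p → ∣ p ∣ ≡ suc ∣ p - x ∣
∣p∣≡1+∣p-x∣ {p = inside ∷ p}  here        = cong suc (sym (cong ∣_∣ (p─⊥≡p p)))
∣p∣≡1+∣p-x∣ {p = inside ∷ p}  (there x∈p) = cong suc (∣p∣≡1+∣p-x∣ x∈p)
∣p∣≡1+∣p-x∣ {p = outside ∷ p} (there x∈p) = ∣p∣≡1+∣p-x∣ x∈p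

x∉p-x : ∀ {n} (p : Subset n) x → x ∉ p - x
x∉p-x (s ∷ p) zero    ()
x∉p-x (s ∷ p) (suc x) (there x∈) = x∉p-x p x x∈

∣p∣<∣p∪⁅x⁆∣ : ∀ {n} {p : Subset n} {x} → x ∉ p → ∣ p ∣ < ∣ p ∪ ⁅ x ⁆ ∣
∣p∣<∣p∪⁅x⁆∣ {x = x} x∉p = p⊂q⇒∣p∣<∣q∣ (p⊆p∪q _ , x , x∈p∪q⁺ (inj₂ (x∈⁅x⁆ x)) , x∉p)

∈p∪⁅x⁆⇒∈p : ∀ {n} {p : Subset n} {x y} → y ∈ p ∪ ⁅ x ⁆ → y ≢ x → y ∈ p
∈p∪⁅x⁆⇒∈p {p = p} {x} y∈ y≢x with x∈p∪q⁻ p ⁅ x ⁆ y∈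
... | inj₁ y∈p = y∈p
... | inj₂ y∈x = ⊥-elim (y≢x (x∈⁅y⁆⇒x≡y x y∈x))

∣p∣≤∣p-x∪⁅y⁆∣ : ∀ {n} {p : Subset n} {x y} → x ∈ p → y ∉ p → ∣ p ∣ ≤ ∣ (p - x) ∪ ⁅ y ⁆ ∣
∣p∣≤∣p-x∪⁅y⁆∣ {p = p} {x} {y} x∈p y∉p = begin
  ∣ p ∣               ≡⟨ ∣p∣≡1+∣p-x∣ x∈p ⟩
  suc ∣ p - x ∣       ≤⟨ ∣p∣<∣p∪⁅x⁆∣ (y∉p ∘ p─q⊆p p ⁅ x ⁆) ⟩
  ∣ (p - x) ∪ ⁅ y ⁆ ∣   ∎
  where open ≤-Reasoning

p∩q⊂[p-x∪⁅y⁆]∩q : ∀ {n} (p q : Subset n) {x y} → x ∉ q → y ∈ q → y ∉ p →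
                   p ∩ q ⊂ ((p - x) ∪ ⁅ y ⁆) ∩ q
p∩q⊂[p-x∪⁅y⁆]∩q p q {x} {y} x∉q y∈q y∉p =
  keep , y , x∈p∩q⁺ (x∈p∪q⁺ (inj₂ (x∈⁅x⁆ y)) , y∈q) , y∉p ∘ proj₁ ∘ x∈p∩q⁻ p q
  where
  keep : p ∩ q ⊆ ((p - x) ∪ ⁅ y ⁆) ∩ q
  keep z∈ with x∈p∩q⁻ p q z∈
  ... | z∈p , z∈q = x∈p∩q⁺ (x∈p∪q⁺ (inj₁ (x∈p∧x≢y⇒x∈p-y z∈p λ { refl → x∉q z∈q })) , z∈q)

module _ (G : Graph) where
  open Graph G

  incident? : ∀ v e → Dec (IncidentTo G v e)
  incident? v e = (proj₁ (ends e) ≟ v) ⊎-dec (proj₂ (ends e) ≟ v)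

  Proper : (k : ℕ) → Subset m → (Fin m → Fin k) → Set
  Proper k H c = ∀ e f → e ∈ H → f ∈ H → e ≢ f → c e ≡ c f →
                 ∀ v → IncidentTo G v e → ¬ IncidentTo G v f

  proper? : ∀ {k} H (c : Fin m → Fin k) → Dec (Proper k H c)
  proper? H c = all? λ e → all? λ f →
    (e ∈? H) →-dec (f ∈? H) →-dec ¬? (e ≟ f) →-dec (c e ≟ c f) →-dec
    all? λ v → incident? v e →-dec ¬? (incident? v f)

  proper-⊆ : ∀ {k H H′} {c : Fin m → Fin k} → H′ ⊆ H → Proper k H c → Proper k H′ c
  proper-⊆ H′⊆H proper e f e∈ f∈ = proper e f (H′⊆H e∈) (H′⊆H f∈)

  proper-resp : ∀ {k H} {c d : Fin m → Fin k} → (∀ e → c e ≡ d e) → Proper k H c → Proper k H d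
  proper-resp c≗d proper e f e∈ f∈ e≢f de≡df =
    proper e f e∈ f∈ e≢f (trans (c≗d e) (trans de≡df (sym (c≗d f))))

  Uncovered : Subset m → Fin n → Set
  Uncovered H v = ∀ e → e ∈ H → ¬ IncidentTo G v e

  Missing : (k : ℕ) → Subset m → (Fin m → Fin k) → Fin k → Fin n → Set
  Missing k H c a v = ∀ e → e ∈ H → IncidentTo G v e → c e ≢ a

  Joins : Fin m → Fin n → Fin n → Set
  Joins e v u = IncidentTo G v e × IncidentTo G u e × (∀ w → IncidentTo G w e → w ≡ v ⊎ w ≡ u)

  opposite : ∀ {v e} → IncidentTo G v e → ∃[ u ] Joins e v u
  opposite (inj₁ refl) = _ , inj₁ refl , inj₂ refl , λ { w (inj₁ refl) → inj₁ refl ; w (inj₂ refl) → inj₂ refl }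
  opposite (inj₂ refl) = _ , inj₂ refl , inj₁ refl , λ { w (inj₁ refl) → inj₂ refl ; w (inj₂ refl) → inj₁ refl }

  recolour : ∀ {k} → Fin m → Fin k → (Fin m → Fin k) → Fin m → Fin k
  recolour e a c g with g ≟ e
  ... | yes _ = a
  ... | no  _ = c g

  recolour-at : ∀ {k} e a (c : Fin m → Fin k) → recolour e a c e ≡ a
  recolour-at e a c with e ≟ e
  ... | yes _   = refl
  ... | no  e≢e = ⊥-elim (e≢e refl)

  recolour-off : ∀ {k e a} {c : Fin m → Fin k} {g} → g ≢ e → recolour e a c g ≡ c g
  recolour-off {e = e} {g = g} g≢e with g ≟ e
  ... | yes g≡e = ⊥-elim (g≢e g≡e)
  ... | no  _   = refl

  proper-extend : ∀ {k H e a} {c : Fin m → Fin k} → Proper k H c →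
                  (∀ w → IncidentTo G w e → Missing k H c a w) →
                  Proper k (H ∪ ⁅ e ⁆) (recolour e a c)
  proper-extend {k} {H} {e} {a} {c} proper free g h g∈ h∈ g≢h same w wg wh = cases (g ≟ e) (h ≟ e)
    where
    clash : ∀ {f} → f ∈ H ∪ ⁅ e ⁆ → f ≢ e → recolour e a c f ≡ a →
            IncidentTo G w e → IncidentTo G w f → ⊥
    clash f∈ f≢e fa we wf = free w we _ (∈p∪⁅x⁆⇒∈p f∈ f≢e) wf (trans (sym (recolour-off f≢e)) fa)

    colour-a : ∀ {f} → f ≡ e → recolour e a c f ≡ a
    colour-a f≡e = trans (cong (recolour e a c) f≡e) (recolour-at e a c)

    cases : Dec (g ≡ e) → Dec (h ≡ e) → ⊥
    cases (yes g≡e) (yes h≡e) = g≢h (trans g≡e (sym h≡e))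
    cases (yes g≡e) (no h≢e)  = clash h∈ h≢e (trans (sym same) (colour-a g≡e)) (subst (IncidentTo G w) g≡e wg) wh
    cases (no g≢e)  (yes h≡e) = clash g∈ g≢e (trans same (colour-a h≡e)) (subst (IncidentTo G w) h≡e wh) wg
    cases (no g≢e)  (no h≢e)  = proper g h (∈p∪⁅x⁆⇒∈p g∈ g≢e) (∈p∪⁅x⁆⇒∈p h∈ h≢e) g≢h
      (trans (sym (recolour-off g≢e)) (trans same (recolour-off h≢e))) w wg wh

  optimalColouring : ∀ {k} → Fin k → (weight : Subset m → ℕ) →
    ∃[ H ] ∃[ c ] (Proper k H c × (∀ H′ (c′ : Fin m → Fin k) → Proper k H′ c′ → weight H′ ≤ weight H))
  optimalColouring {k} a weight =
    H , lookup cs , proper ,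
    λ H′ c′ proper′ → best (H′ , tabulate c′) (proper-resp (λ e → sym (lookup∘tabulate c′ e)) proper′)
    where
    Configuration : Set
    Configuration = Subset m × Vec (Fin k) m
    Properᵥ : Configuration → Set
    Properᵥ (H , cs) = Proper k H (lookup cs)
    configurations : List Configuration
    configurations = cartesianProduct (vectors (true ∷ₗ false ∷ₗ []ₗ) m) (vectors (allFin k) m)
    complete : ∀ x → x ∈ₗ configurations
    complete (H , cs) = ∈-cartesianProduct⁺ (∈-vectors bool H) (∈-vectors ∈-allFin cs)
      where
      bool : ∀ b → b ∈ₗ true ∷ₗ false ∷ₗ []ₗ
      bool true  = Any.here refl
      bool false = Any.there (Any.here refl)
    emptyProper : Properᵥ (∅ , replicate m a)
    emptyProper e f e∈ = ⊥-elim (∉⊥ e∈)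
    found : ∃[ x ] (Properᵥ x × (∀ y → Properᵥ y → weight (proj₁ y) ≤ weight (proj₁ x)))
    found = maximiser (λ (H , cs) → proper? H (lookup cs)) (weight ∘ proj₁)
                      configurations complete {∅ , replicate m a} emptyProper
    H : Subset m
    H = proj₁ (proj₁ found)
    cs : Vec (Fin k) m
    cs = proj₂ (proj₁ found)
    proper : Proper k H (lookup cs)
    proper = proj₁ (proj₂ found)
    best : ∀ y → Properᵥ y → weight (proj₁ y) ≤ weight H
    best = proj₂ (proj₂ found)

  module Exchange (M : Subset m) (M-matching : Matching G M) (M-spanning : Spanning G M) (k : ℕ) where

    score : Subset m → ℕ
    score H = lexWeight m ∣ H ∣ ∣ H ∩ M ∣

    Improvable : Subset m → Set
    Improvable H = ∃[ H′ ] ∃[ c′ ] (Proper k H′ c′ × score H < score H′)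

    augment : ∀ {H c e v u} → Proper k H c → Joins e v u →
              Uncovered H v → Uncovered H u → Fin k → Improvable H
    augment {H} {c} {e} proper (ve , ue , ends-e) v-free u-free a =
      H ∪ ⁅ e ⁆ , recolour e a c , proper-extend proper free ,
      lexWeight-<ˡ _ _ (∣p∣≤n (H ∩ M)) (∣p∣<∣p∪⁅x⁆∣ λ e∈H → v-free e e∈H ve)
      where
      free : ∀ w → IncidentTo G w e → Missing k H c a w
      free w we f f∈H wf _ with ends-e w we
      ... | inj₁ refl = v-free f f∈H wf
      ... | inj₂ refl = u-free f f∈H wf

    -- If e ∈ M joins an uncovered v to a vertex u covered by f ∈ H, exchange f
    -- for e, giving e the colour of f: H keeps its size and gains an edge of M.
    swap : ∀ {H c e f v u} → Proper k H c → e ∈ M → Joins e v u →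
           Uncovered H v → f ∈ H → IncidentTo G u f → Improvable H
    swap {H} {c} {e} {f} {u = u} proper e∈M (ve , ue , ends-e) v-free f∈H uf =
      (H - f) ∪ ⁅ e ⁆ , recolour e (c f) c ,
      proper-extend (proper-⊆ H-f⊆H proper) free ,
      lexWeight-<ʳ (∣p∣≤∣p-x∪⁅y⁆∣ f∈H e∉H) (p⊂q⇒∣p∣<∣q∣ (p∩q⊂[p-x∪⁅y⁆]∩q H M f∉M e∈M e∉H))
      where
      H-f⊆H : H - f ⊆ H
      H-f⊆H = p─q⊆p H ⁅ f ⁆
      e∉H : e ∉ H
      e∉H e∈H = v-free e e∈H ve
      -- f shares the vertex u with the matching edge e
      f∉M : f ∉ M
      f∉M f∈M = M-matching e f e∈M f∈M (λ { refl → e∉H f∈H }) u ue uf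
      free : ∀ w → IncidentTo G w e → Missing k (H - f) c (c f) w
      free w we g g∈ wg cg≡cf with ends-e w we
      ... | inj₁ refl = v-free g (H-f⊆H g∈) wg
      ... | inj₂ refl = proper g f (H-f⊆H g∈) f∈H (λ { refl → x∉p-x H g g∈ }) cg≡cf w wg uf

    uncovered⇒improvable : ∀ {H c v} → Fin k → Proper k H c → Uncovered H v → Improvable H
    uncovered⇒improvable {H} {v = v} a proper v-free with M-spanning v
    ... | e , e∈M , ve with opposite ve
    ... | u , joins with any? (λ f → (f ∈? H) ×-dec incident? u f)
    ... | yes (f , f∈H , uf) = swap proper e∈M joins v-free f∈H uf
    ... | no  u-uncovered    = augment proper joins v-free (λ f f∈H uf → u-uncovered (f , f∈H , uf)) a

    Optimal : Subset m → Set
    Optimal H = ∀ H′ (c′ : Fin m → Fin k) → Proper k H′ c′ → score H′ ≤ score H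

    optimal⇒maximum : ∀ {H} → Optimal H → ∀ H′ → KEdgeColorable G k H′ → ∣ H′ ∣ ≤ ∣ H ∣
    optimal⇒maximum {H} optimal H′ (c′ , proper′) = lexWeight-≤⇒≤ (∣p∣≤n (H ∩ M)) (optimal H′ c′ proper′)

    optimal⇒spanning : ∀ {H c} → Fin k → Proper k H c → Optimal H → Spanning G H
    optimal⇒spanning {H} a proper optimal v with any? (λ e → (e ∈? H) ×-dec incident? v e)
    ... | yes covered = covered
    ... | no  uncovered with uncovered⇒improvable a proper (λ e e∈H ve → uncovered (e , e∈H , ve))
    ...   | H′ , c′ , proper′ , better = ⊥-elim (<⇒≱ better (optimal H′ c′ proper′))

mainTheorem3 : (G : Graph) → HasPerfectMatching G → (k : ℕ) → 1 ≤ k →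
    ∃[ H ] (MaxKEdgeColorable G k H × Spanning G H)
mainTheorem3 G (M , M-matching , M-spanning) (suc k′) _
  with optimalColouring G zero (Exchange.score G M M-matching M-spanning (suc k′))
... | H , c , proper , optimal =
  H , ((c , proper) , optimal⇒maximum {H} optimal) , optimal⇒spanning zero proper optimal
  where open Exchange G M M-matching M-spanning (suc k′)
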